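{- Let $P=([n],\preceq)$ be a poset and $0\le r\le n$. A $P$-code $\mathcal{C}\subseteq F^n$ is $r$-error-correcting if and only if for all distinct $c_1,c_2\in\mathcal{C}$ and all $I',I''\in\mathcal{I}_P^r$ we have $c_1+c_2\not\subseteq I'\cup I''$.
   Context: $[n]=\{1,\dots,n\}$; subsets of $[n]$ are identified with their characteristic vectors in $F^n=\{0,1\}^n$, and $x+y$ is the symmetric difference. An ideal of $P$ is a set $I\subseteq[n]$ such that $a\in I$ and $b\preceq a$ imply $b\in I$; ${<}X{>}$ is the smallest ideal containing $X$. $\mathcal{I}_P^r$ is the set of ideals of cardinality $r$. The $P$-weight is $w_P(x)=|{<}x{>}|$ and $\mathcal{B}_P^r=\{x\in F^n: w_P(x)\le r\}$. A $P$-code $\mathcal{C}\subseteq F^n$ is $r$-error-correcting if every $x\in F^n$ has at most one representation $x=c+b$ with $c\in\mathcal{C}$, $b\in\mathcal{B}_P^r$. -}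

module Defs where

open import Data.Nat using (ℕ; _≤_)
open import Data.Bool using (Bool; _xor_; _∧_)
open import Data.Fin using (Fin)
open import Data.Fin.Subset using (Subset; _∈_; _⊆_; ∣_∣)
open import Data.Fin.Subset.Properties using (_∈?_)
open import Relation.Nullary.Decidable using (_×-dec_)
open import Data.Fin.Properties using (any?)
open import Data.Vec using (zipWith; tabulate; lookup)
open import Relation.Binary.PropositionalEquality using (_≡_)
open import Relation.Binary.Definitions using (Decidable)
open import Relation.Binary.Structures using (IsPartialOrder)
open import Relation.Nullary.Decidable using (⌊_⌋)
open import Data.Product using (_×_; ∃)

-- A poset P = ([n], ≼): a partial order on Fin n (w.r.t. ≡), with a
-- decision procedure for ≼ (always available classically on a finite set).
record FinPoset (n : ℕ) : Set₁ where
  field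
    _≼_ : Fin n → Fin n → Set
    isPartialOrder : IsPartialOrder _≡_ _≼_
    _≼?_ : Decidable _≼_

module _ {n : ℕ} (P : FinPoset n) where
  open FinPoset P

  -- x + y : symmetric difference (sum in F^n = {0,1}^n)
  _⊕_ : Subset n → Subset n → Subset n
  _⊕_ = zipWith _xor_

  IsIdeal : Subset n → Set
  IsIdeal I = ∀ {a b} → a ∈ I → b ≼ a → b ∈ I

  IdealOfSize : ℕ → Subset n → Set
  IdealOfSize r I = IsIdeal I × ∣ I ∣ ≡ r

  ⟨_⟩ : Subset n → Subset n
  ⟨ X ⟩ = tabulate λ b → ⌊ any? (λ a → (a ∈? X) ×-dec (b ≼? a)) ⌋

  wP : Subset n → ℕ
  wP x = ∣ ⟨ x ⟩ ∣

  InBall : ℕ → Subset n → Set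
  InBall r x = wP x ≤ r

  ErrorCorrecting : ℕ → (Subset n → Set) → Set
  ErrorCorrecting r C =
    ∀ c₁ b₁ c₂ b₂ → C c₁ → C c₂ → InBall r b₁ → InBall r b₂ →
    c₁ ⊕ b₁ ≡ c₂ ⊕ b₂ → (c₁ ≡ c₂ × b₁ ≡ b₂)

-- If c₁ + b₁ = c₂ + b₂ with c₁ ≠ c₂, then c₁ + c₂ = b₁ + b₂ ⊆ b₁ ∪ b₂, and each error bᵢ of
-- P-weight at most r lies in an ideal of size exactly r: enlarge ⟨bᵢ⟩ by a minimal element of
-- its complement until it has r elements (possible since r ≤ n). Conversely, if
-- c₁ + c₂ ⊆ I′ ∪ I″, the errors b₁ = (c₁ + c₂) ∩ I′ and b₂ = (c₁ + c₂) ∖ I′ lie in I′ and I″,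
-- so have P-weight at most r, and c₁ + b₁ = c₂ + b₂ exhibits two decodings.

module Submission where

open import Defs
open import Data.Nat using (ℕ; _≤_)
open import Data.Fin.Subset using (Subset; _⊆_; _∪_)
open import Relation.Binary.PropositionalEquality using (_≡_)
open import Relation.Nullary using (¬_)
open import Data.Product using (_×_)
open import Function.Bundles using (_⇔_)

open import Data.Bool as Bool using (true; false; _xor_)
open import Data.Bool.Properties
  using (xor-assoc; xor-comm; xor-identityˡ; xor-same; xor-inverseʳ; ∧-distribˡ-xor)
open import Data.Nat using (zero; suc; _<_; s≤s⁻¹)
open import Data.Nat.Properties using (n≤0⇒n≡0; m≤n⇒m<n∨m≡n; <⇒≤; <⇒≱)
open import Data.Nat.Induction using (<-wellFounded)
open import Data.Fin using (Fin; _≟_) renaming (zero to fzero; suc to fsuc)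
open import Data.Fin.Properties using (any?)
open import Data.Fin.Subset using (_∈_; _∉_; _∩_; ∁; ⁅_⁆; ⊤; ⊥; ∣_∣)
open import Data.Fin.Subset.Properties
  using (_∈?_; ∩-identityʳ; ∪-identityʳ; x∈p∩q⁻; x∈p∪q⁻; x∈p∪q⁺; p⊆p∪q; x∈∁p⇒x∉p;
         x∈⁅x⁆; x∈⁅y⁆⇒x≡y; ⊆-reflexive; ∣⊤∣≡n; p⊆q⇒∣p∣≤∣q∣; p⊂q⇒∣p∣<∣q∣)
open import Data.Vec using ([]; _∷_; zipWith; tabulate; here; there)
open import Data.Vec.Properties
  using (≡-dec; zipWith-assoc; zipWith-comm; zipWith-identityˡ; zipWith-inverseʳ;
         zipWith-distribˡ; lookup∘tabulate; []=⇒lookup; lookup⇒[]=)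
open import Data.Product using (∃; _,_; proj₁; proj₂)
open import Data.Empty using (⊥-elim)
open import Data.Sum as Sum using (_⊎_; inj₁; inj₂)
open import Function using (_∘_; id; _on_)
open import Function.Bundles using (mk⇔)
open import Induction.WellFounded using (Acc; acc)
open import Relation.Binary.Construct.On as On using ()
open import Relation.Binary.PropositionalEquality using (_≢_; refl; sym; trans; cong; cong₂; subst; module ≡-Reasoning)
open import Relation.Binary.Structures using (IsPartialOrder)
open import Relation.Nullary using (Dec; yes; no; ¬?; contradiction)
open import Relation.Nullary.Decidable using (⌊_⌋; dec-true; isYes≗does; _×-dec_)
open import Relation.Unary using (Decidable)

private
  variable
    n : ℕ

infixl 6 _△_

-- Definitionally equal to the symmetric difference `_⊕_ P` of Defs.
_△_ : Subset n → Subset n → Subset n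
_△_ = zipWith _xor_

△-assoc : ∀ (p q s : Subset n) → (p △ q) △ s ≡ p △ (q △ s)
△-assoc = zipWith-assoc xor-assoc

△-comm : ∀ (p q : Subset n) → p △ q ≡ q △ p
△-comm = zipWith-comm xor-comm

△-self : ∀ (p : Subset n) → p △ p ≡ ⊥
△-self [] = refl
△-self (x ∷ p) = cong₂ _∷_ (xor-same x) (△-self p)

△-involutiveˡ : ∀ (p q : Subset n) → p △ (p △ q) ≡ q
△-involutiveˡ p q = begin
  p △ (p △ q)  ≡⟨ sym (△-assoc p p q) ⟩
  (p △ p) △ q  ≡⟨ cong (_△ q) (△-self p) ⟩
  ⊥ △ q        ≡⟨ zipWith-identityˡ xor-identityˡ q ⟩
  q            ∎
  where open ≡-Reasoning

△-cancelˡ : ∀ (p : Subset n) {q s} → p △ q ≡ p △ s → q ≡ s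
△-cancelˡ p {q} {s} e = begin
  q            ≡⟨ sym (△-involutiveˡ p q) ⟩
  p △ (p △ q)  ≡⟨ cong (p △_) e ⟩
  p △ (p △ s)  ≡⟨ △-involutiveˡ p s ⟩
  s            ∎
  where open ≡-Reasoning

△-exchange : ∀ {p q s t : Subset n} → p △ q ≡ s △ t → p △ s ≡ q △ t
△-exchange {p = p} {q} {s} {t} e = begin
  p △ s              ≡⟨ cong (_△ s) (sym (△-involutiveˡ q p)) ⟩
  q △ (q △ p) △ s    ≡⟨ cong (λ u → q △ u △ s) (trans (△-comm q p) e) ⟩
  q △ (s △ t) △ s    ≡⟨ △-assoc q (s △ t) s ⟩
  q △ (s △ t △ s)    ≡⟨ cong (q △_) (trans (△-comm (s △ t) s) (△-involutiveˡ s t)) ⟩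
  q △ t              ∎
  where open ≡-Reasoning

∩△∩∁ : ∀ (p q : Subset n) → (p ∩ q) △ (p ∩ ∁ q) ≡ p
∩△∩∁ p q = begin
  (p ∩ q) △ (p ∩ ∁ q)  ≡⟨ sym (zipWith-distribˡ ∧-distribˡ-xor p q (∁ q)) ⟩
  p ∩ (q △ ∁ q)        ≡⟨ cong (p ∩_) (zipWith-inverseʳ xor-inverseʳ q) ⟩
  p ∩ ⊤                ≡⟨ ∩-identityʳ p ⟩
  p                    ∎
  where open ≡-Reasoning

△⊆∪ : ∀ (p q : Subset n) → p △ q ⊆ p ∪ q
△⊆∪ (true ∷ p) (false ∷ q) here = here
△⊆∪ (false ∷ p) (true ∷ q) here = here
△⊆∪ (_ ∷ p) (_ ∷ q) (there x∈) = there (△⊆∪ p q x∈)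

module _ {P : Fin n → Set} (P? : Decidable P) where

  ∈-tabulate⁺ : ∀ {x} → P x → x ∈ tabulate (λ y → ⌊ P? y ⌋)
  ∈-tabulate⁺ {x} px = lookup⇒[]= x _
    (trans (lookup∘tabulate _ x) (trans (isYes≗does (P? x)) (dec-true (P? x) px)))

  ∈-tabulate⁻ : ∀ {x} → x ∈ tabulate (λ y → ⌊ P? y ⌋) → P x
  ∈-tabulate⁻ {x} x∈ = true⇒holds (P? x) (trans (sym (lookup∘tabulate _ x)) ([]=⇒lookup x∈))
    where
    true⇒holds : ∀ {A : Set} (a? : Dec A) → ⌊ a? ⌋ ≡ true → A
    true⇒holds (yes a) _ = a

∣p∪⁅x⁆∣≡1+∣p∣ : (p : Subset n) {x : Fin n} → x ∉ p → ∣ p ∪ ⁅ x ⁆ ∣ ≡ suc ∣ p ∣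
∣p∪⁅x⁆∣≡1+∣p∣ (true ∷ p) {fzero} x∉p = contradiction here x∉p
∣p∪⁅x⁆∣≡1+∣p∣ (false ∷ p) {fzero} _ = cong (suc ∘ ∣_∣) (∪-identityʳ p)
∣p∪⁅x⁆∣≡1+∣p∣ (true ∷ p) {fsuc x} x∉p = cong suc (∣p∪⁅x⁆∣≡1+∣p∣ p (x∉p ∘ there))
∣p∪⁅x⁆∣≡1+∣p∣ (false ∷ p) {fsuc x} x∉p = ∣p∪⁅x⁆∣≡1+∣p∣ p (x∉p ∘ there)

∣p∣<n⇒∃∉ : ∀ {n} (p : Subset n) → ∣ p ∣ < n → ∃ λ x → x ∉ p
∣p∣<n⇒∃∉ {n} p ∣p∣<n with any? (λ x → ¬? (x ∈? p))
... | yes x∉p = x∉p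
... | no ¬∃∉ = contradiction n≤∣p∣ (<⇒≱ ∣p∣<n)
  where
  ⊤⊆p : ⊤ ⊆ p
  ⊤⊆p {x} _ with x ∈? p
  ... | yes x∈p = x∈p
  ... | no x∉p = contradiction (x , x∉p) ¬∃∉
  n≤∣p∣ : n ≤ ∣ p ∣
  n≤∣p∣ = subst (_≤ ∣ p ∣) (∣⊤∣≡n n) (p⊆q⇒∣p∣≤∣q∣ ⊤⊆p)

module _ {n : ℕ} (P : FinPoset n) where
  open FinPoset P
  open IsPartialOrder isPartialOrder using (antisym) renaming (refl to ≼-refl; trans to ≼-trans)

  ∈⟨⟩⁺ : ∀ {X a b} → a ∈ X → b ≼ a → b ∈ ⟨_⟩ P X
  ∈⟨⟩⁺ {X} a∈X b≼a = ∈-tabulate⁺ (λ b → any? (λ a → (a ∈? X) ×-dec (b ≼? a))) (_ , a∈X , b≼a)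

  ∈⟨⟩⁻ : ∀ {X b} → b ∈ ⟨_⟩ P X → ∃ λ a → a ∈ X × b ≼ a
  ∈⟨⟩⁻ {X} = ∈-tabulate⁻ (λ b → any? (λ a → (a ∈? X) ×-dec (b ≼? a)))

  X⊆⟨X⟩ : ∀ X → X ⊆ ⟨_⟩ P X
  X⊆⟨X⟩ X x∈X = ∈⟨⟩⁺ x∈X ≼-refl

  ⟨⟩-isIdeal : ∀ X → IsIdeal P (⟨_⟩ P X)
  ⟨⟩-isIdeal X a∈⟨X⟩ b≼a with ∈⟨⟩⁻ a∈⟨X⟩
  ... | c , c∈X , a≼c = ∈⟨⟩⁺ c∈X (≼-trans b≼a a≼c)

  ⟨⟩-least : ∀ {X I} → IsIdeal P I → X ⊆ I → ⟨_⟩ P X ⊆ I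
  ⟨⟩-least isIdeal X⊆I b∈⟨X⟩ with ∈⟨⟩⁻ b∈⟨X⟩
  ... | a , a∈X , b≼a = isIdeal (X⊆I a∈X) b≼a

  wP≤∣ideal∣ : ∀ {x I} → IsIdeal P I → x ⊆ I → wP P x ≤ ∣ I ∣
  wP≤∣ideal∣ isIdeal x⊆I = p⊆q⇒∣p∣≤∣q∣ (⟨⟩-least isIdeal x⊆I)

  wP⁅⁆-strictMono : ∀ {a b} → b ≼ a → b ≢ a → wP P ⁅ b ⁆ < wP P ⁅ a ⁆
  wP⁅⁆-strictMono {a} {b} b≼a b≢a =
    p⊂q⇒∣p∣<∣q∣ (⟨⁅b⁆⟩⊆⟨⁅a⁆⟩ , a , X⊆⟨X⟩ ⁅ a ⁆ (x∈⁅x⁆ a) , a∉⟨⁅b⁆⟩)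
    where
    ⟨⁅b⁆⟩⊆⟨⁅a⁆⟩ : ⟨_⟩ P ⁅ b ⁆ ⊆ ⟨_⟩ P ⁅ a ⁆
    ⟨⁅b⁆⟩⊆⟨⁅a⁆⟩ = ⟨⟩-least (⟨⟩-isIdeal ⁅ a ⁆)
      (λ x∈⁅b⁆ → ∈⟨⟩⁺ (x∈⁅x⁆ a) (subst (_≼ a) (sym (x∈⁅y⁆⇒x≡y b x∈⁅b⁆)) b≼a))
    a∉⟨⁅b⁆⟩ : a ∉ ⟨_⟩ P ⁅ b ⁆
    a∉⟨⁅b⁆⟩ a∈⟨⁅b⁆⟩ with ∈⟨⟩⁻ a∈⟨⁅b⁆⟩
    ... | c , c∈⁅b⁆ , a≼c = b≢a (antisym b≼a (subst (a ≼_) (x∈⁅y⁆⇒x≡y b c∈⁅b⁆) a≼c))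

  IsMinimalOutside : Subset n → Fin n → Set
  IsMinimalOutside I m = m ∉ I × (∀ {b} → b ≼ m → b ∈ I ⊎ b ≡ m)

  -- Descend below a while staying outside I; the measure wP ⁅ a ⁆ = ∣ ⟨ {a} ⟩ ∣ strictly decreases.
  minimalOutside : ∀ I {a} → a ∉ I → ∃ (IsMinimalOutside I)
  minimalOutside I a∉I = descend a∉I (On.wellFounded (λ a → wP P ⁅ a ⁆) <-wellFounded _)
    where
    descend : ∀ {a} → a ∉ I → Acc (_<_ on λ a → wP P ⁅ a ⁆) a → ∃ (IsMinimalOutside I)
    descend {a} a∉I (acc smaller) with any? (λ b → ¬? (b ∈? I) ×-dec (b ≼? a) ×-dec ¬? (b ≟ a))
    ... | yes (b , b∉I , b≼a , b≢a) = descend b∉I (smaller (wP⁅⁆-strictMono b≼a b≢a))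
    ... | no ¬below = a , a∉I , below
      where
      below : ∀ {b} → b ≼ a → b ∈ I ⊎ b ≡ a
      below {b} b≼a with b ∈? I | b ≟ a
      ... | yes b∈I | _ = inj₁ b∈I
      ... | no _ | yes b≡a = inj₂ b≡a
      ... | no b∉I | no b≢a = contradiction (b , b∉I , b≼a , b≢a) ¬below

  ∪⁅minimal⁆-isIdeal : ∀ {I m} → IsIdeal P I → IsMinimalOutside I m → IsIdeal P (I ∪ ⁅ m ⁆)
  ∪⁅minimal⁆-isIdeal {I} {m} isIdeal (_ , below) {a} {b} a∈ b≼a with x∈p∪q⁻ I ⁅ m ⁆ a∈
  ... | inj₁ a∈I = x∈p∪q⁺ (inj₁ (isIdeal a∈I b≼a))
  ... | inj₂ a∈⁅m⁆ with below (subst (b ≼_) (x∈⁅y⁆⇒x≡y m a∈⁅m⁆) b≼a)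
  ...   | inj₁ b∈I = x∈p∪q⁺ (inj₁ b∈I)
  ...   | inj₂ refl = x∈p∪q⁺ (inj₂ (x∈⁅x⁆ b))

  idealOfSize-grow : ∀ {r I} → IdealOfSize P r I → r < n → ∃ λ J → IdealOfSize P (suc r) J × I ⊆ J
  idealOfSize-grow {I = I} (isIdeal , refl) ∣I∣<n with ∣p∣<n⇒∃∉ I ∣I∣<n
  ... | a , a∉I with minimalOutside I a∉I
  ...   | m , minimal@(m∉I , _) =
          I ∪ ⁅ m ⁆ , (∪⁅minimal⁆-isIdeal isIdeal minimal , ∣p∪⁅x⁆∣≡1+∣p∣ I m∉I) , p⊆p∪q ⁅ m ⁆

  ideal-extend : ∀ {I} r → IsIdeal P I → ∣ I ∣ ≤ r → r ≤ n → ∃ λ J → IdealOfSize P r J × I ⊆ J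
  ideal-extend zero isIdeal ∣I∣≤0 _ = _ , (isIdeal , n≤0⇒n≡0 ∣I∣≤0) , id
  ideal-extend (suc r) isIdeal ∣I∣≤1+r 1+r≤n with m≤n⇒m<n∨m≡n ∣I∣≤1+r
  ... | inj₂ ∣I∣≡1+r = _ , (isIdeal , ∣I∣≡1+r) , id
  ... | inj₁ ∣I∣<1+r with ideal-extend r isIdeal (s≤s⁻¹ ∣I∣<1+r) (<⇒≤ 1+r≤n)
  ...   | J , J-size , I⊆J with idealOfSize-grow J-size 1+r≤n
  ...     | K , K-size , J⊆K = K , K-size , J⊆K ∘ I⊆J

  ball⊆idealOfSize : ∀ {r x} → r ≤ n → InBall P r x → ∃ λ J → IdealOfSize P r J × x ⊆ J
  ball⊆idealOfSize {r} {x} r≤n x∈ball with ideal-extend r (⟨⟩-isIdeal x) x∈ball r≤n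
  ... | J , J-size , ⟨x⟩⊆J = J , J-size , ⟨x⟩⊆J ∘ X⊆⟨X⟩ x

  NoDifferenceInTwoIdeals : ℕ → (Subset n → Set) → Set
  NoDifferenceInTwoIdeals r C =
    ∀ c₁ c₂ → C c₁ → C c₂ → ¬ c₁ ≡ c₂ → ∀ I′ I″ →
      IdealOfSize P r I′ → IdealOfSize P r I″ → ¬ (_⊕_ P c₁ c₂ ⊆ I′ ∪ I″)

  errorCorrecting⇒noDifferenceInTwoIdeals :
    ∀ {r C} → ErrorCorrecting P r C → NoDifferenceInTwoIdeals r C
  errorCorrecting⇒noDifferenceInTwoIdeals {r} errorCorrecting
    c₁ c₂ c₁∈C c₂∈C c₁≢c₂ I′ I″ (I′-ideal , ∣I′∣≡r) (I″-ideal , ∣I″∣≡r) d⊆I′∪I″ =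
    c₁≢c₂ (proj₁ (errorCorrecting c₁ b₁ c₂ b₂ c₁∈C c₂∈C b₁∈ball b₂∈ball
                    (△-exchange (sym (∩△∩∁ d I′)))))
    where
    d b₁ b₂ : Subset n
    d = c₁ △ c₂
    b₁ = d ∩ I′
    b₂ = d ∩ ∁ I′
    b₂⊆I″ : b₂ ⊆ I″
    b₂⊆I″ x∈b₂ with x∈p∩q⁻ d (∁ I′) x∈b₂
    ... | x∈d , x∈∁I′ with x∈p∪q⁻ I′ I″ (d⊆I′∪I″ x∈d)
    ...   | inj₁ x∈I′ = contradiction x∈I′ (x∈∁p⇒x∉p x∈∁I′)
    ...   | inj₂ x∈I″ = x∈I″
    b₁∈ball : InBall P r b₁
    b₁∈ball = subst (wP P b₁ ≤_) ∣I′∣≡r (wP≤∣ideal∣ I′-ideal (proj₂ ∘ x∈p∩q⁻ d I′))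
    b₂∈ball : InBall P r b₂
    b₂∈ball = subst (wP P b₂ ≤_) ∣I″∣≡r (wP≤∣ideal∣ I″-ideal b₂⊆I″)

  noDifferenceInTwoIdeals⇒errorCorrecting :
    ∀ {r C} → r ≤ n → NoDifferenceInTwoIdeals r C → ErrorCorrecting P r C
  noDifferenceInTwoIdeals⇒errorCorrecting r≤n noDifference
    c₁ b₁ c₂ b₂ c₁∈C c₂∈C b₁∈ball b₂∈ball c₁+b₁≡c₂+b₂ with ≡-dec Bool._≟_ c₁ c₂
  ... | yes refl = refl , △-cancelˡ c₁ c₁+b₁≡c₂+b₂
  ... | no c₁≢c₂ with ball⊆idealOfSize r≤n b₁∈ball | ball⊆idealOfSize r≤n b₂∈ball
  ...   | J₁ , J₁-size , b₁⊆J₁ | J₂ , J₂-size , b₂⊆J₂ =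
          ⊥-elim (noDifference c₁ c₂ c₁∈C c₂∈C c₁≢c₂ J₁ J₂ J₁-size J₂-size d⊆J₁∪J₂)
    where
    d⊆J₁∪J₂ : c₁ △ c₂ ⊆ J₁ ∪ J₂
    d⊆J₁∪J₂ = x∈p∪q⁺ ∘ Sum.map b₁⊆J₁ b₂⊆J₂ ∘ x∈p∪q⁻ b₁ b₂ ∘ △⊆∪ b₁ b₂ ∘ ⊆-reflexive (△-exchange c₁+b₁≡c₂+b₂)

proposition3 : (n : ℕ) (P : FinPoset n) (r : ℕ) → r ≤ n → (C : Subset n → Set) →
    ErrorCorrecting P r C ⇔
      (∀ c₁ c₂ → C c₁ → C c₂ → ¬ c₁ ≡ c₂ → ∀ I′ I″ →
        IdealOfSize P r I′ → IdealOfSize P r I″ → ¬ (_⊕_ P c₁ c₂ ⊆ I′ ∪ I″))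
proposition3 n P r r≤n C =
  mk⇔ (errorCorrecting⇒noDifferenceInTwoIdeals P)
      (noDifferenceInTwoIdeals⇒errorCorrecting P r≤n)
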